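{- Let $u$ be an $m\times n$ matrix with entries in $\{0,1\}$, viewed as a two-player zero-sum game, and suppose $u$ is balanced. Then (1) $\mathscr{V}(u)=\mathrm{floor}(u)=\mathrm{ceil}(u)$; and (2) the strategy profile $(\bar{\mu},\bar{\nu})$, where $\bar{\mu}$ is Eloise's uniform mixed strategy on the rows and $\bar{\nu}$ is Abelard's uniform mixed strategy on the columns, is an equilibrium in $u$.
   Context: A game is an $m\times n$ matrix $u$ with entries in $\{0,1\}$; Eloise chooses a row $i$, Abelard a column $j$, Eloise receives $u(i,j)$ and Abelard $1-u(i,j)$. Mixed strategies $\mu$ (rows) and $\nu$ (columns) are probability distributions; $U(\mu,\nu)=\sum_{i,j}\mu(i)\nu(j)u(i,j)$ is Eloise's expected utility. $\mathscr{V}(u)=\max_\mu\min_\nu U(\mu,\nu)$. A profile $(\mu,\nu)$ is an equilibrium if $U(\mu',\nu)\le U(\mu,\nu)\le U(\mu,\nu')$ for all mixed strategies $\mu',\nu'$. Row sums $\Sigma\mathrm{row}^u(i)=\sum_j u(i,j)$, column sums $\Sigma\mathrm{col}^u(j)=\sum_i u(i,j)$; $u$ is balanced if all row sums are equal and all column sums are equal. $\mathrm{floor}(u)=\min_j\Sigma\mathrm{col}^u(j)/m$ and $\mathrm{ceil}(u)=\max_i\Sigma\mathrm{row}^u(i)/n$.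
   Formalization: The mixed strategies, including the deviations $\mu',\nu'$ in the equilibrium condition and those ranged over in $\mathscr{V}(u)$, are probability distributions with rational values. -}

module Defs where

open import Data.Bool using (Bool; true; false)
open import Data.Nat using (ℕ; zero; suc; NonZero)
open import Data.Fin using (Fin; zero; suc)
open import Data.Integer using (+_)
open import Data.Rational using (ℚ; 0ℚ; 1ℚ; _+_; _*_; _-_; _≤_; _⊓_; _⊔_; _/_)
open import Data.Product using (Σ; _×_; ∃)
open import Relation.Binary.PropositionalEquality using (_≡_)

-- A game: an m × n matrix with entries in {0,1} (true = 1, false = 0).
Game : ℕ → ℕ → Set
Game m n = Fin m → Fin n → Bool

bitℕ : Bool → ℕ
bitℕ true  = 1
bitℕ false = 0

bitℚ : Bool → ℚ
bitℚ true  = 1ℚ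
bitℚ false = 0ℚ

sumℕ : ∀ n → (Fin n → ℕ) → ℕ
sumℕ zero    f = 0
sumℕ (suc n) f = f zero Data.Nat.+ sumℕ n (λ i → f (suc i))

sumℚ : ∀ n → (Fin n → ℚ) → ℚ
sumℚ zero    f = 0ℚ
sumℚ (suc n) f = f zero + sumℚ n (λ i → f (suc i))

-- min / max over Fin n (only meaningful for n ≥ 1; default 0 for n = 0)
minFin : ∀ n → (Fin n → ℚ) → ℚ
minFin zero          f = 0ℚ
minFin (suc zero)    f = f zero
minFin (suc (suc n)) f = f zero ⊓ minFin (suc n) (λ i → f (suc i))

maxFin : ∀ n → (Fin n → ℚ) → ℚ
maxFin zero          f = 0ℚ
maxFin (suc zero)    f = f zero
maxFin (suc (suc n)) f = f zero ⊔ maxFin (suc n) (λ i → f (suc i))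

Σrow : ∀ {m n} → Game m n → Fin m → ℕ
Σrow {m} {n} u i = sumℕ n (λ j → bitℕ (u i j))

Σcol : ∀ {m n} → Game m n → Fin n → ℕ
Σcol {m} {n} u j = sumℕ m (λ i → bitℕ (u i j))

Balanced : ∀ {m n} → Game m n → Set
Balanced u = (∀ i i' → Σrow u i ≡ Σrow u i') × (∀ j j' → Σcol u j ≡ Σcol u j')

floorG : ∀ {m n} .{{_ : NonZero m}} → Game m n → ℚ
floorG {m} {n} u = minFin n (λ j → (+ Σcol u j) / m)

ceilG : ∀ {m n} .{{_ : NonZero n}} → Game m n → ℚ
ceilG {m} {n} u = maxFin m (λ i → (+ Σrow u i) / n)

IsMixed : ∀ k → (Fin k → ℚ) → Set
IsMixed k p = (∀ i → 0ℚ ≤ p i) × (sumℚ k p ≡ 1ℚ)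

U : ∀ {m n} → Game m n → (Fin m → ℚ) → (Fin n → ℚ) → ℚ
U {m} {n} u μ ν = sumℚ m (λ i → sumℚ n (λ j → μ i * ν j * bitℚ (u i j)))

-- v = max_μ min_ν U(μ,ν): some mixed μ guarantees at least v against every ν,
-- and every mixed μ is held to at most v by some ν (both extrema attained).
IsValue : ∀ {m n} → Game m n → ℚ → Set
IsValue {m} {n} u v =
  (Σ (Fin m → ℚ) λ μ → IsMixed m μ × (∀ ν → IsMixed n ν → v ≤ U u μ ν)) ×
  (∀ μ → IsMixed m μ → Σ (Fin n → ℚ) λ ν → IsMixed n ν × (U u μ ν ≤ v))

IsEquilibrium : ∀ {m n} → Game m n → (Fin m → ℚ) → (Fin n → ℚ) → Set
IsEquilibrium {m} {n} u μ ν =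
  IsMixed m μ × IsMixed n ν ×
  (∀ μ' → IsMixed m μ' → U u μ' ν ≤ U u μ ν) ×
  (∀ ν' → IsMixed n ν' → U u μ ν ≤ U u μ ν')

uniform : ∀ k .{{_ : NonZero k}} → Fin k → ℚ
uniform k i = (+ 1) / k

-- Against the uniform strategy of Abelard, a row i earns Eloise Σrow(i)/n, and
-- against the uniform strategy of Eloise, a column j concedes Σcol(j)/m. In a
-- balanced game these are constants r/n and c/m, so each player is indifferent
-- among all mixed strategies when the opponent plays uniformly. Evaluating U at
-- the uniform profile both ways gives c/m = r/n, and mutual indifference at a
-- common payoff v makes the uniform profile an equilibrium with value v.
module Submission where

open import Defs
open import Data.Nat using (ℕ; NonZero)
open import Data.Product using (_×_)
open import Relation.Binary.PropositionalEquality using (_≡_)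

open import Algebra.Bundles using (CommutativeMonoid)
open import Data.Bool using (Bool; true; false)
open import Data.Nat as ℕ using (zero; suc)
open import Data.Fin using (Fin; zero; suc)
open import Data.Integer as ℤ using (+_)
import Data.Integer.Properties as ℤP
import Data.Nat.Properties as ℕP
open import Data.Product using (_,_)
open import Data.Rational using (ℚ; 0ℚ; 1ℚ; _+_; _*_; _/_; _⊓_; _⊔_; toℚᵘ)
import Data.Rational.Properties as ℚP
open import Data.Rational.Unnormalised as ℚᵘ using (mkℚᵘ; *≡*)
import Data.Rational.Unnormalised.Properties as ℚᵘP
open import Relation.Binary.PropositionalEquality
  using (refl; sym; trans; cong; cong₂; module ≡-Reasoning)

open import Algebra.Properties.CommutativeSemigroup
  (CommutativeMonoid.commutativeSemigroup ℚP.+-0-commutativeMonoid)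
  using (interchange)
open import Algebra.Properties.CommutativeSemigroup
  (CommutativeMonoid.commutativeSemigroup ℚP.*-1-commutativeMonoid)
  using (xy∙z≈y∙xz)

sumℚ-cong : ∀ n {f g : Fin n → ℚ} → (∀ i → f i ≡ g i) → sumℚ n f ≡ sumℚ n g
sumℚ-cong zero    f≗g = refl
sumℚ-cong (suc n) f≗g = cong₂ _+_ (f≗g zero) (sumℚ-cong n (λ i → f≗g (suc i)))

sumℚ-zero : ∀ n → sumℚ n (λ _ → 0ℚ) ≡ 0ℚ
sumℚ-zero zero    = refl
sumℚ-zero (suc n) = trans (ℚP.+-identityˡ _) (sumℚ-zero n)

sumℚ-*ˡ : ∀ n a (f : Fin n → ℚ) → sumℚ n (λ i → a * f i) ≡ a * sumℚ n f
sumℚ-*ˡ zero    a f = sym (ℚP.*-zeroʳ a)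
sumℚ-*ˡ (suc n) a f =
  trans (cong (_+_ (a * f zero)) (sumℚ-*ˡ n a (λ i → f (suc i))))
        (sym (ℚP.*-distribˡ-+ a (f zero) _))

sumℚ-+ : ∀ n (f g : Fin n → ℚ) →
         sumℚ n (λ i → f i + g i) ≡ sumℚ n f + sumℚ n g
sumℚ-+ zero    f g = refl
sumℚ-+ (suc n) f g =
  trans (cong (_+_ (f zero + g zero)) (sumℚ-+ n (λ i → f (suc i)) (λ i → g (suc i))))
        (interchange (f zero) (g zero) _ _)

sumℚ-comm : ∀ m n (g : Fin m → Fin n → ℚ) →
            sumℚ m (λ i → sumℚ n (g i)) ≡ sumℚ n (λ j → sumℚ m (λ i → g i j))
sumℚ-comm zero    n g = sym (sumℚ-zero n)
sumℚ-comm (suc m) n g =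
  trans (cong (_+_ (sumℚ n (g zero))) (sumℚ-comm m n (λ i → g (suc i))))
        (sym (sumℚ-+ n (g zero) _))

sumℕ-const-1 : ∀ k → sumℕ k (λ _ → 1) ≡ k
sumℕ-const-1 zero    = refl
sumℕ-const-1 (suc k) = cong suc (sumℕ-const-1 k)

fromℕ : ℕ → ℚ
fromℕ n = + n / 1

toℚᵘ-/ : ∀ p d → toℚᵘ (p / suc d) ℚᵘ.≃ mkℚᵘ p d
toℚᵘ-/ p d = ℚP.toℚᵘ-fromℚᵘ (mkℚᵘ p d)

fromℕ-homo-+ : ∀ a b → fromℕ (a ℕ.+ b) ≡ fromℕ a + fromℕ b
fromℕ-homo-+ a b = ℚP.toℚᵘ-injective (begin
  toℚᵘ (fromℕ (a ℕ.+ b))              ≈⟨ toℚᵘ-/ (+ (a ℕ.+ b)) 0 ⟩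
  mkℚᵘ (+ (a ℕ.+ b)) 0                ≈⟨ integral-sum ⟩
  mkℚᵘ (+ a) 0 ℚᵘ.+ mkℚᵘ (+ b) 0      ≈⟨ ℚᵘP.+-cong (toℚᵘ-/ (+ a) 0) (toℚᵘ-/ (+ b) 0) ⟨
  toℚᵘ (fromℕ a) ℚᵘ.+ toℚᵘ (fromℕ b)  ≈⟨ ℚP.toℚᵘ-homo-+ (fromℕ a) (fromℕ b) ⟨
  toℚᵘ (fromℕ a + fromℕ b)            ∎)
  where
  open ℚᵘP.≃-Reasoning
  integral-sum : mkℚᵘ (+ (a ℕ.+ b)) 0 ℚᵘ.≃ mkℚᵘ (+ a) 0 ℚᵘ.+ mkℚᵘ (+ b) 0
  integral-sum = *≡* (cong (ℤ._* + 1) (trans (ℤP.pos-+ a b)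
    (sym (cong₂ ℤ._+_ (ℤP.*-identityʳ (+ a)) (ℤP.*-identityʳ (+ b))))))

sumℚ-fromℕ : ∀ k (f : Fin k → ℕ) → sumℚ k (λ i → fromℕ (f i)) ≡ fromℕ (sumℕ k f)
sumℚ-fromℕ zero    f = refl
sumℚ-fromℕ (suc k) f =
  trans (cong (_+_ (fromℕ (f zero))) (sumℚ-fromℕ k (λ i → f (suc i))))
        (sym (fromℕ-homo-+ (f zero) _))

bitℚ≡fromℕ-bitℕ : ∀ b → bitℚ b ≡ fromℕ (bitℕ b)
bitℚ≡fromℕ-bitℕ true  = refl
bitℚ≡fromℕ-bitℕ false = refl

sumℚ-bitℚ : ∀ k (f : Fin k → Bool) →
            sumℚ k (λ i → bitℚ (f i)) ≡ fromℕ (sumℕ k (λ i → bitℕ (f i)))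
sumℚ-bitℚ k f = trans (sumℚ-cong k (λ i → bitℚ≡fromℕ-bitℕ (f i)))
                      (sumℚ-fromℕ k (λ i → bitℕ (f i)))

1/k*fromℕ : ∀ k .{{_ : NonZero k}} s → (+ 1 / k) * fromℕ s ≡ + s / k
1/k*fromℕ k@(suc k-1) s = ℚP.toℚᵘ-injective (begin
  toℚᵘ ((+ 1 / k) * fromℕ s)           ≈⟨ ℚP.toℚᵘ-homo-* (+ 1 / k) (fromℕ s) ⟩
  toℚᵘ (+ 1 / k) ℚᵘ.* toℚᵘ (fromℕ s)  ≈⟨ ℚᵘP.*-cong (toℚᵘ-/ (+ 1) k-1) (toℚᵘ-/ (+ s) 0) ⟩
  mkℚᵘ (+ 1) k-1 ℚᵘ.* mkℚᵘ (+ s) 0    ≈⟨ *≡* (cong₂ ℤ._*_ (ℤP.*-identityˡ (+ s))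
                                            (cong (λ d → + suc d) (sym (ℕP.*-identityʳ k-1)))) ⟩
  mkℚᵘ (+ s) k-1                      ≈⟨ toℚᵘ-/ (+ s) k-1 ⟨
  toℚᵘ (+ s / k)                      ∎)
  where open ℚᵘP.≃-Reasoning

n/n≡1 : ∀ n .{{_ : NonZero n}} → + n / n ≡ 1ℚ
n/n≡1 (suc k) = ℚP.toℚᵘ-injective
  (ℚᵘP.≃-trans (toℚᵘ-/ (+ suc k) k) (*≡* (ℤP.*-comm (+ suc k) (+ 1))))

uniform-isMixed : ∀ k .{{_ : NonZero k}} → IsMixed k (uniform k)
uniform-isMixed k = (λ _ → ℚP.nonNegative⁻¹ _ {{ℚP.normalize-nonNeg 1 k}}) , (begin
  sumℚ k (λ _ → q)              ≡⟨ sumℚ-cong k (λ _ → sym (ℚP.*-identityʳ q)) ⟩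
  sumℚ k (λ _ → q * fromℕ 1)    ≡⟨ sumℚ-*ˡ k q (λ _ → fromℕ 1) ⟩
  q * sumℚ k (λ _ → fromℕ 1)    ≡⟨ cong (q *_) (sumℚ-fromℕ k (λ _ → 1)) ⟩
  q * fromℕ (sumℕ k (λ _ → 1))  ≡⟨ cong (λ s → q * fromℕ s) (sumℕ-const-1 k) ⟩
  q * fromℕ k                   ≡⟨ 1/k*fromℕ k k ⟩
  + k / k                       ≡⟨ n/n≡1 k ⟩
  1ℚ                            ∎)
  where
  open ≡-Reasoning
  q = + 1 / k

expectation-const : ∀ k {w f : Fin k → ℚ} {c} → IsMixed k w → (∀ i → f i ≡ c) →
                    sumℚ k (λ i → w i * f i) ≡ c
expectation-const k {w} {f} {c} (_ , w-sums-to-1) f≡c = begin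
  sumℚ k (λ i → w i * f i) ≡⟨ sumℚ-cong k (λ i → trans (cong (w i *_) (f≡c i)) (ℚP.*-comm (w i) c)) ⟩
  sumℚ k (λ i → c * w i)   ≡⟨ sumℚ-*ˡ k c w ⟩
  c * sumℚ k w             ≡⟨ cong (c *_) w-sums-to-1 ⟩
  c * 1ℚ                   ≡⟨ ℚP.*-identityʳ c ⟩
  c                        ∎
  where open ≡-Reasoning

minFin-const : ∀ n .{{_ : NonZero n}} {f : Fin n → ℚ} {c} → (∀ i → f i ≡ c) → minFin n f ≡ c
minFin-const (suc zero)    f≡c = f≡c zero
minFin-const (suc (suc n)) {c = c} f≡c =
  trans (cong₂ _⊓_ (f≡c zero) (minFin-const (suc n) (λ i → f≡c (suc i)))) (ℚP.⊓-idem c)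

maxFin-const : ∀ n .{{_ : NonZero n}} {f : Fin n → ℚ} {c} → (∀ i → f i ≡ c) → maxFin n f ≡ c
maxFin-const (suc zero)    f≡c = f≡c zero
maxFin-const (suc (suc n)) {c = c} f≡c =
  trans (cong₂ _⊔_ (f≡c zero) (maxFin-const (suc n) (λ i → f≡c (suc i)))) (ℚP.⊔-idem c)

module _ {m n} (u : Game m n) where

  U-uniformʳ : ∀ .{{_ : NonZero n}} μ → U u μ (uniform n) ≡ sumℚ m (λ i → μ i * (+ Σrow u i / n))
  U-uniformʳ μ = sumℚ-cong m λ i → begin
    sumℚ n (λ j → μ i * q * bitℚ (u i j))   ≡⟨ sumℚ-*ˡ n (μ i * q) (λ j → bitℚ (u i j)) ⟩
    μ i * q * sumℚ n (λ j → bitℚ (u i j))   ≡⟨ ℚP.*-assoc (μ i) q _ ⟩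
    μ i * (q * sumℚ n (λ j → bitℚ (u i j))) ≡⟨ cong (λ s → μ i * (q * s)) (sumℚ-bitℚ n (u i)) ⟩
    μ i * (q * fromℕ (Σrow u i))           ≡⟨ cong (μ i *_) (1/k*fromℕ n (Σrow u i)) ⟩
    μ i * (+ Σrow u i / n)                 ∎
    where
    open ≡-Reasoning
    q = + 1 / n

  U-uniformˡ : ∀ .{{_ : NonZero m}} ν → U u (uniform m) ν ≡ sumℚ n (λ j → ν j * (+ Σcol u j / m))
  U-uniformˡ ν = trans (sumℚ-comm m n (λ i j → q * ν j * bitℚ (u i j))) (sumℚ-cong n λ j → begin
    sumℚ m (λ i → q * ν j * bitℚ (u i j))   ≡⟨ sumℚ-cong m (λ i → xy∙z≈y∙xz q (ν j) (bitℚ (u i j))) ⟩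
    sumℚ m (λ i → ν j * (q * bitℚ (u i j))) ≡⟨ sumℚ-*ˡ m (ν j) _ ⟩
    ν j * sumℚ m (λ i → q * bitℚ (u i j))   ≡⟨ cong (ν j *_) (sumℚ-*ˡ m q _) ⟩
    ν j * (q * sumℚ m (λ i → bitℚ (u i j))) ≡⟨ cong (λ s → ν j * (q * s)) (sumℚ-bitℚ m (λ i → u i j)) ⟩
    ν j * (q * fromℕ (Σcol u j))           ≡⟨ cong (ν j *_) (1/k*fromℕ m (Σcol u j)) ⟩
    ν j * (+ Σcol u j / m)                 ∎)
    where
    open ≡-Reasoning
    q = + 1 / m

module _ {m n} (u : Game m n) {μ̄ : Fin m → ℚ} {ν̄ : Fin n → ℚ} {v : ℚ}
         (μ̄-mixed : IsMixed m μ̄) (ν̄-mixed : IsMixed n ν̄)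
         (rows-indifferent : ∀ μ → IsMixed m μ → U u μ ν̄ ≡ v)
         (cols-indifferent : ∀ ν → IsMixed n ν → U u μ̄ ν ≡ v) where

  indifferent⇒isValue : IsValue u v
  indifferent⇒isValue =
    (μ̄ , μ̄-mixed , λ ν ν-mixed → ℚP.≤-reflexive (sym (cols-indifferent ν ν-mixed))) ,
    (λ μ μ-mixed → ν̄ , ν̄-mixed , ℚP.≤-reflexive (rows-indifferent μ μ-mixed))

  indifferent⇒isEquilibrium : IsEquilibrium u μ̄ ν̄
  indifferent⇒isEquilibrium = μ̄-mixed , ν̄-mixed ,
    (λ μ μ-mixed → ℚP.≤-reflexive (trans (rows-indifferent μ μ-mixed)
                                         (sym (rows-indifferent μ̄ μ̄-mixed)))) ,
    (λ ν ν-mixed → ℚP.≤-reflexive (trans (cols-indifferent ν̄ ν̄-mixed)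
                                         (sym (cols-indifferent ν ν-mixed))))

module ConstantLineSums {m n} .{{_ : NonZero m}} .{{_ : NonZero n}} (u : Game m n) {r c : ℕ}
         (rows≡r : ∀ i → Σrow u i ≡ r) (cols≡c : ∀ j → Σcol u j ≡ c) where

  rows-indifferent : ∀ μ → IsMixed m μ → U u μ (uniform n) ≡ + r / n
  rows-indifferent μ μ-mixed = trans (U-uniformʳ u μ)
    (expectation-const m μ-mixed (λ i → cong (λ s → + s / n) (rows≡r i)))

  cols-indifferent : ∀ ν → IsMixed n ν → U u (uniform m) ν ≡ + c / m
  cols-indifferent ν ν-mixed = trans (U-uniformˡ u ν)
    (expectation-const n ν-mixed (λ j → cong (λ s → + s / m) (cols≡c j)))

  c/m≡r/n : + c / m ≡ + r / n
  c/m≡r/n = trans (sym (cols-indifferent (uniform n) (uniform-isMixed n)))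
                  (rows-indifferent (uniform m) (uniform-isMixed m))

  floorG≡c/m : floorG u ≡ + c / m
  floorG≡c/m = minFin-const n (λ j → cong (λ s → + s / m) (cols≡c j))

  ceilG≡r/n : ceilG u ≡ + r / n
  ceilG≡r/n = maxFin-const m (λ i → cong (λ s → + s / n) (rows≡r i))

proposition3 : ∀ (m n : ℕ) .{{_ : NonZero m}} .{{_ : NonZero n}} (u : Game m n) →
    Balanced u →
    (IsValue u (floorG u) × floorG u ≡ ceilG u) ×
    IsEquilibrium u (uniform m) (uniform n)
proposition3 m@(suc _) n@(suc _) u (rows-balanced , cols-balanced) =
  (indifferent⇒isValue u μ̄-mixed ν̄-mixed rows-at-floor cols-at-floor ,
   trans floorG≡c/m (trans c/m≡r/n (sym ceilG≡r/n))) ,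
  indifferent⇒isEquilibrium u μ̄-mixed ν̄-mixed rows-at-floor cols-at-floor
  where
  open ConstantLineSums u (λ i → rows-balanced i zero) (λ j → cols-balanced j zero)
  μ̄-mixed = uniform-isMixed m
  ν̄-mixed = uniform-isMixed n

  rows-at-floor : ∀ μ → IsMixed m μ → U u μ (uniform n) ≡ floorG u
  rows-at-floor μ μ-mixed =
    trans (rows-indifferent μ μ-mixed) (sym (trans floorG≡c/m c/m≡r/n))

  cols-at-floor : ∀ ν → IsMixed n ν → U u (uniform m) ν ≡ floorG u
  cols-at-floor ν ν-mixed = trans (cols-indifferent ν ν-mixed) (sym floorG≡c/m)
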